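{- Let $C$ be a cycle (set of lines) with positive line weights $w_{ij}>0$ for $(i,j)\in C$, and let $M$ be a constant with $M > w(\overline{\rho}_{mn})$ (in particular $M\ge \sum_{(i,j)\in C}w_{ij}$ suffices). Let $m\neq n$ be two buses on $C$; $C$ is partitioned into two edge-disjoint paths $\underline{\rho}_{mn}$ and $\overline{\rho}_{mn}$ connecting $m$ and $n$, with $w(\underline{\rho}_{mn}) < w(\overline{\rho}_{mn})$, where $w(\rho):=\sum_{(i,j)\in\rho}w_{ij}$. Then the polytope $$Q=\Bigl\{(\delta\theta_{mn},y)\in \mathbb{R}\times[0,1]^{|C|} : |\delta\theta_{mn}|\le w(\underline{\rho}_{mn}) + \sum_{(i,j)\in\underline{\rho}_{mn}}(M-w_{ij})(1-y_{ij}),\ |\delta\theta_{mn}|\le w(\overline{\rho}_{mn}) + \sum_{(i,j)\in\overline{\rho}_{mn}}(M-w_{ij})(1-y_{ij}),\ |\delta\theta_{mn}|\le M\Bigr\}$$ is full-dimensional in $\mathbb{R}^{|C|+1}$.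
   Context: This arises from DC optimal transmission switching: $y_{ij}$ indicates whether line $(i,j)$ is active, $w_{ij}=\overline{f}_{ij}x_{ij}$, and $\delta\theta_{mn}=\theta_n-\theta_m$ is a voltage-angle difference. In the paper, $M$ is the sum of the weights of all lines of the network containing $C$, and the set $Q$ is denoted $\operatorname{conv}(\mathcal{R}^{\delta\theta,y}_{+_{\langle m,n\rangle}})$. -}

module Defs where

open import Level using (Level; _⊔_) renaming (suc to lsuc)
import Data.Nat as N
open import Data.Nat using (ℕ; suc)
open import Data.Fin using (Fin; toℕ) renaming (suc to fsuc; zero to fzero)
open import Data.Bool using (Bool; true; false; if_then_else_)
open import Data.Product using (_×_; Σ)
open import Algebra.Bundles using (CommutativeRing)
open import Relation.Binary.Structures using (IsTotalOrder)
open import Relation.Nullary using (¬_)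

-- An ordered field (the paper works over ℝ, which is one; stdlib has no reals).
record OrderedField c ℓ : Set (lsuc (c ⊔ ℓ)) where
  field
    commRing : CommutativeRing c ℓ
  open CommutativeRing commRing public
  field
    _≤_          : Carrier → Carrier → Set ℓ
    isTotalOrder : IsTotalOrder _≈_ _≤_
    +-mono-≤     : ∀ {x y} z → x ≤ y → (x + z) ≤ (y + z)
    *-nonneg     : ∀ {x y} → 0# ≤ x → 0# ≤ y → 0# ≤ (x * y)
    0≉1          : ¬ (0# ≈ 1#)
    inverse      : ∀ x → ¬ (x ≈ 0#) → Σ Carrier (λ y → (x * y) ≈ 1#)

  _<_ : Carrier → Carrier → Set ℓ
  x < y = (x ≤ y) × ¬ (x ≈ y)

module _ {c ℓ} (F : OrderedField c ℓ) where
  open OrderedField F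

  Σ[_] : ∀ {k} → (Fin k → Carrier) → Carrier
  Σ[_] {ℕ.zero} f = 0#
  Σ[_] {suc k} f = f fzero + Σ[_] (λ i → f (fsuc i))

  AbsLe : Carrier → Carrier → Set ℓ
  AbsLe x b = (x ≤ b) × ((- x) ≤ b)

  AffinelyIndependent : ∀ {N d} → (Fin N → Fin d → Carrier) → Set (c ⊔ ℓ)
  AffinelyIndependent {N} {d} q =
    (λ' : Fin N → Carrier) →
    Σ[ λ' ] ≈ 0# →
    (∀ j → Σ[ (λ i → λ' i * q i j) ] ≈ 0#) →
    ∀ i → λ' i ≈ 0#

  -- A set S ⊆ ℝ^d is full-dimensional (dim S = d) iff it contains d+1
  -- affinely independent points.
  FullDimensional : ∀ d → ((Fin d → Carrier) → Set ℓ) → Set (c ⊔ ℓ)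
  FullDimensional d S =
    Σ (Fin (suc d) → Fin d → Carrier)
      (λ q → ((i : Fin (suc d)) → S (q i)) × AffinelyIndependent q)

-- Cycle C with k lines and k buses: line i joins bus i and bus (i+1 mod k).
-- inArc k m n i = true iff line i lies on the path from bus m to bus n
-- traversing the cycle in increasing index direction.
inArc : (k : ℕ) → Fin k → Fin k → Fin k → Bool
inArc k m n i = ((toℕ i N.+ k N.∸ toℕ m) N.% suc (k N.∸ 1)) N.<ᵇ ((toℕ n N.+ k N.∸ toℕ m) N.% suc (k N.∸ 1))

module Polytope {c ℓ} (F : OrderedField c ℓ) (k : ℕ) (w : Fin k → OrderedField.Carrier F)
                (M : OrderedField.Carrier F) (m n : Fin k) where
  open OrderedField F

  wArc : Fin k → Fin k → Carrier
  wArc a b = Σ[ F ] (λ i → if inArc k a b i then w i else 0#)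

  slack : Fin k → Fin k → (Fin k → Carrier) → Carrier
  slack a b y = Σ[ F ] (λ i → if inArc k a b i then (M - w i) * (1# - y i) else 0#)

  -- lower path ρ̲ = arc m n, upper path ρ̄ = arc n m.
  -- A point p ∈ ℝ^{k+1}: p fzero = δθ_mn, p (suc i) = y_i.
  Q : (Fin (suc k) → Carrier) → Set ℓ
  Q p =
    (∀ i → (0# ≤ y i) × (y i ≤ 1#)) ×
    AbsLe F δθ (wArc m n + slack m n y) ×
    AbsLe F δθ (wArc n m + slack n m y) ×
    AbsLe F δθ M
    where
      δθ = p fzero
      y : Fin k → Carrier
      y i = p (fsuc i)

{-# OPTIONS --safe #-}
module Submission where

-- Q contains the k + 2 points (0, 0), (w(ρ̲), 1, …, 1) and (0, e_t) for every
-- line t of C.  A point (0, y) with y in the unit cube satisfies all constraints,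
-- because each summand w_ij + (M - w_ij)(1 - y_ij) of a right-hand side equals
-- the convex combination y_ij w_ij + (1 - y_ij) M of non-negative numbers; at
-- y = 1 the right-hand sides are w(ρ̲) ≤ w(ρ̄) < M.  These points are affinely
-- independent since w(ρ̲) ≥ w_m > 0, the line leaving m being the first line of ρ̲.

open import Defs
open import Data.Nat using (ℕ; zero; suc)
open import Data.Fin using (Fin; toℕ; zero; suc)
open import Relation.Binary.PropositionalEquality using (_≡_)
open import Relation.Nullary using (¬_; contradiction)

open import Data.Bool using (true; false; if_then_else_)
open import Data.Bool.Properties using (T-≡)
open import Data.Fin.Properties using (toℕ<n; toℕ-injective)
open import Data.Product using (_×_; _,_; proj₁; proj₂)
open import Data.Sum using (inj₁; inj₂)
open import Data.Vec.Functional using (_∷_)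
open import Function using (_∘_; const; Equivalence)
open import Relation.Binary.Structures using (IsTotalOrder)
open import Relation.Binary.Definitions using (tri<; tri≈; tri>)
import Relation.Binary.PropositionalEquality as ≡
import Algebra.Properties.AbelianGroup as AbelianGroupProperties
import Algebra.Properties.CommutativeMonoid.Sum as SumProperties
import Algebra.Properties.Ring as RingProperties
import Relation.Binary.Reasoning.Setoid as ≈-Reasoning

module OrderedFieldProperties {c ℓ} (F : OrderedField c ℓ) where
  -- Defs gives _≤_ and _<_ no fixity, so they would bind tighter than _+_ and -_.
  open OrderedField F hiding (zero) renaming (_≤_ to infix 4 _≤_; _<_ to infix 4 _<_)
  open RingProperties ring using (-1*x≈-x; -‿involutive; [y-z]x≈yx-zx; x[y-z]≈xy-xz)
  open AbelianGroupProperties +-abelianGroup using (⁻¹-anti-homo‿-; xyx⁻¹≈y)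
  open IsTotalOrder isTotalOrder public using (total; antisym; ≤-respˡ-≈; ≤-respʳ-≈)
    renaming (refl to ≤-refl; trans to ≤-trans; reflexive to ≤-reflexive)
  open SumProperties +-commutativeMonoid using (sum; sum-cong-≋; ∑-distrib-+; sum-replicate-zero)

  _∈[0,1] : Carrier → Set ℓ
  x ∈[0,1] = 0# ≤ x × x ≤ 1#

  x≤y⇒0≤y-x : ∀ {x y} → x ≤ y → 0# ≤ y - x
  x≤y⇒0≤y-x {x} {y} x≤y = ≤-respˡ-≈ (-‿inverseʳ x) (+-mono-≤ (- x) x≤y)

  0≤x⇒-x≤0 : ∀ {x} → 0# ≤ x → - x ≤ 0#
  0≤x⇒-x≤0 {x} 0≤x = ≤-respˡ-≈ (+-identityˡ (- x)) (≤-respʳ-≈ (-‿inverseʳ x) (+-mono-≤ (- x) 0≤x))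

  0≤1 : 0# ≤ 1#
  0≤1 with total 0# 1#
  ... | inj₁ 0≤1 = 0≤1
  ... | inj₂ 1≤0 = ≤-respʳ-≈ [-1][-1]≈1 (*-nonneg 0≤-1 0≤-1)
    where
    0≤-1 : 0# ≤ - 1#
    0≤-1 = ≤-respʳ-≈ (+-identityˡ (- 1#)) (x≤y⇒0≤y-x 1≤0)
    [-1][-1]≈1 : - 1# * - 1# ≈ 1#
    [-1][-1]≈1 = trans (-1*x≈-x (- 1#)) (-‿involutive 1#)

  +-nonneg : ∀ {x y} → 0# ≤ x → 0# ≤ y → 0# ≤ x + y
  +-nonneg {x} {y} 0≤x 0≤y = ≤-trans 0≤y (≤-respˡ-≈ (+-identityˡ y) (+-mono-≤ y 0≤x))

  x≤x+y : ∀ x {y} → 0# ≤ y → x ≤ x + y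
  x≤x+y x {y} 0≤y = ≤-respˡ-≈ (+-identityˡ x) (≤-respʳ-≈ (+-comm y x) (+-mono-≤ x 0≤y))

  <-≤-trans : ∀ {x y z} → x < y → y ≤ z → x < z
  <-≤-trans (x≤y , x≉y) y≤z =
    ≤-trans x≤y y≤z , λ x≈z → x≉y (antisym x≤y (≤-respʳ-≈ (sym x≈z) y≤z))

  *-zero-cancelʳ : ∀ {x y} → ¬ y ≈ 0# → x * y ≈ 0# → x ≈ 0#
  *-zero-cancelʳ {x} {y} y≉0 xy≈0 with inverse y y≉0
  ... | y⁻¹ , yy⁻¹≈1 = begin
    x              ≈⟨ *-identityʳ x ⟨
    x * 1#         ≈⟨ *-congˡ yy⁻¹≈1 ⟨
    x * (y * y⁻¹)  ≈⟨ *-assoc x y y⁻¹ ⟨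
    x * y * y⁻¹    ≈⟨ *-congʳ xy≈0 ⟩
    0# * y⁻¹       ≈⟨ zeroˡ y⁻¹ ⟩
    0#             ∎
    where open ≈-Reasoning setoid

  x+[y-x][1-t]≈xt+y[1-t] : ∀ x y t → x + (y - x) * (1# - t) ≈ x * t + y * (1# - t)
  x+[y-x][1-t]≈xt+y[1-t] x y t = begin
    x + (y - x) * (1# - t)                ≈⟨ +-congˡ ([y-z]x≈yx-zx (1# - t) y x) ⟩
    x + (y * (1# - t) - x * (1# - t))     ≈⟨ +-congˡ (+-comm _ _) ⟩
    x + (- (x * (1# - t)) + y * (1# - t)) ≈⟨ +-assoc _ _ _ ⟨
    x - x * (1# - t) + y * (1# - t)       ≈⟨ +-congʳ x-x[1-t]≈xt ⟩
    x * t + y * (1# - t)                  ∎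
    where
    open ≈-Reasoning setoid
    x-x[1-t]≈xt : x - x * (1# - t) ≈ x * t
    x-x[1-t]≈xt = begin
      x - x * (1# - t)       ≈⟨ +-congʳ (*-identityʳ x) ⟨
      x * 1# - x * (1# - t)  ≈⟨ x[y-z]≈xy-xz x 1# (1# - t) ⟨
      x * (1# - (1# - t))    ≈⟨ *-congˡ (+-congˡ (⁻¹-anti-homo‿- 1# t)) ⟩
      x * (1# + (t - 1#))    ≈⟨ *-congˡ (+-assoc 1# t (- 1#)) ⟨
      x * (1# + t - 1#)      ≈⟨ *-congˡ (xyx⁻¹≈y 1# t) ⟩
      x * t                  ∎

  convex-nonneg : ∀ {x y t} → 0# ≤ x → 0# ≤ y → t ∈[0,1] → 0# ≤ x + (y - x) * (1# - t)
  convex-nonneg {x} {y} {t} 0≤x 0≤y (0≤t , t≤1) =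
    ≤-respʳ-≈ (sym (x+[y-x][1-t]≈xt+y[1-t] x y t))
      (+-nonneg (*-nonneg 0≤x 0≤t) (*-nonneg 0≤y (x≤y⇒0≤y-x t≤1)))

  AbsLe-nonneg : ∀ {x b} → 0# ≤ x → x ≤ b → AbsLe F x b
  AbsLe-nonneg 0≤x x≤b = x≤b , ≤-trans (0≤x⇒-x≤0 0≤x) (≤-trans 0≤x x≤b)

  if-nonneg : ∀ b {x} → 0# ≤ x → 0# ≤ (if b then x else 0#)
  if-nonneg true  0≤x = 0≤x
  if-nonneg false _   = ≤-refl

  if-distrib-+ : ∀ b x y → (if b then x + y else 0#) ≈ (if b then x else 0#) + (if b then y else 0#)
  if-distrib-+ true  x y = refl
  if-distrib-+ false x y = sym (+-identityʳ 0#)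

  Σ≡sum : ∀ {k} (f : Fin k → Carrier) → Σ[ F ] f ≡ sum f
  Σ≡sum {zero}  f = ≡.refl
  Σ≡sum {suc k} f = ≡.cong (f zero +_) (Σ≡sum (f ∘ suc))

  Σ-distrib-+ : ∀ {k} (f g : Fin k → Carrier) → Σ[ F ] (λ i → f i + g i) ≈ Σ[ F ] f + Σ[ F ] g
  Σ-distrib-+ f g rewrite Σ≡sum f | Σ≡sum g | Σ≡sum (λ i → f i + g i) = ∑-distrib-+ f g

  Σ-zero : ∀ {k} {f : Fin k → Carrier} → (∀ i → f i ≈ 0#) → Σ[ F ] f ≈ 0#
  Σ-zero {k} {f} f≈0 rewrite Σ≡sum f = trans (sum-cong-≋ f≈0) (sum-replicate-zero k)

  Σ-nonneg : ∀ {k} {f : Fin k → Carrier} → (∀ i → 0# ≤ f i) → 0# ≤ Σ[ F ] f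
  Σ-nonneg {zero}  _   = ≤-refl
  Σ-nonneg {suc k} 0≤f = +-nonneg (0≤f zero) (Σ-nonneg (0≤f ∘ suc))

  term≤Σ : ∀ {k} {f : Fin k → Carrier} → (∀ i → 0# ≤ f i) → ∀ j → f j ≤ Σ[ F ] f
  term≤Σ 0≤f zero    = x≤x+y _ (Σ-nonneg (0≤f ∘ suc))
  term≤Σ 0≤f (suc j) = ≤-trans (term≤Σ (0≤f ∘ suc) j) (≤-respʳ-≈ (+-comm _ _) (x≤x+y _ (0≤f zero)))

module Simplex {c ℓ} (F : OrderedField c ℓ) where
  open OrderedField F hiding (zero)
  open OrderedFieldProperties F

  δ : ∀ {k} → Fin k → Fin k → Carrier
  δ zero    zero    = 1#
  δ zero    (suc _) = 0#
  δ (suc _) zero    = 0#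
  δ (suc i) (suc j) = δ i j

  δ∈[0,1] : ∀ {k} (i j : Fin k) → δ i j ∈[0,1]
  δ∈[0,1] zero    zero    = 0≤1 , ≤-refl
  δ∈[0,1] zero    (suc _) = ≤-refl , 0≤1
  δ∈[0,1] (suc _) zero    = ≤-refl , 0≤1
  δ∈[0,1] (suc i) (suc j) = δ∈[0,1] i j

  Σ-δ : ∀ {k} (g : Fin k → Carrier) j → Σ[ F ] (λ i → g i * δ i j) ≈ g j
  Σ-δ g zero    = trans (+-cong (*-identityʳ (g zero)) (Σ-zero (λ i → zeroʳ (g (suc i))))) (+-identityʳ (g zero))
  Σ-δ g (suc j) = trans (+-cong (zeroʳ (g zero)) (Σ-δ (g ∘ suc) j)) (+-identityˡ (g (suc j)))

  simplex : ∀ {d} → Carrier → (Fin d → Carrier) → Fin (suc (suc d)) → Fin (suc d) → Carrier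
  simplex ε u = const 0# ∷ (ε ∷ u) ∷ λ t → 0# ∷ δ t

  simplex-affinelyIndependent : ∀ {d ε} (u : Fin d → Carrier) → ¬ ε ≈ 0# →
                                AffinelyIndependent F (simplex ε u)
  simplex-affinelyIndependent {ε = ε} u ε≉0 α Σα≈0 Σαq≈0 = α≈0
    where
    open ≈-Reasoning setoid

    α₁≈0 : α (suc zero) ≈ 0#
    α₁≈0 = *-zero-cancelʳ ε≉0 (trans (sym coordinate₀) (Σαq≈0 zero))
      where
      coordinate₀ : Σ[ F ] (λ i → α i * simplex ε u i zero) ≈ α (suc zero) * ε
      coordinate₀ = begin
        α zero * 0# + (α (suc zero) * ε + Σ[ F ] (λ t → α (suc (suc t)) * 0#))
          ≈⟨ +-cong (zeroʳ _) (+-congˡ (Σ-zero (λ t → zeroʳ (α (suc (suc t)))))) ⟩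
        0# + (α (suc zero) * ε + 0#)  ≈⟨ +-identityˡ _ ⟩
        α (suc zero) * ε + 0#         ≈⟨ +-identityʳ _ ⟩
        α (suc zero) * ε              ∎

    α₂₊≈0 : ∀ t → α (suc (suc t)) ≈ 0#
    α₂₊≈0 t = trans (sym coordinate₁₊) (Σαq≈0 (suc t))
      where
      coordinate₁₊ : Σ[ F ] (λ i → α i * simplex ε u i (suc t)) ≈ α (suc (suc t))
      coordinate₁₊ = begin
        α zero * 0# + (α (suc zero) * u t + Σ[ F ] (λ s → α (suc (suc s)) * δ s t))
          ≈⟨ +-cong (zeroʳ _) (+-cong (trans (*-congʳ α₁≈0) (zeroˡ _)) (Σ-δ (λ s → α (suc (suc s))) t)) ⟩
        0# + (0# + α (suc (suc t)))  ≈⟨ +-identityˡ _ ⟩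
        0# + α (suc (suc t))         ≈⟨ +-identityˡ _ ⟩
        α (suc (suc t))              ∎

    α₀≈0 : α zero ≈ 0#
    α₀≈0 = begin
      α zero                                                     ≈⟨ +-identityʳ _ ⟨
      α zero + 0#                                                ≈⟨ +-congˡ (+-identityˡ 0#) ⟨
      α zero + (0# + 0#)                                         ≈⟨ +-congˡ (+-cong α₁≈0 (Σ-zero α₂₊≈0)) ⟨
      α zero + (α (suc zero) + Σ[ F ] (λ t → α (suc (suc t))))   ≈⟨ Σα≈0 ⟩
      0#                                                         ∎

    α≈0 : ∀ i → α i ≈ 0#
    α≈0 zero          = α₀≈0
    α≈0 (suc zero)    = α₁≈0
    α≈0 (suc (suc t)) = α₂₊≈0 t

module PolytopeProperties {c ℓ} (F : OrderedField c ℓ) (k : ℕ) (w : Fin k → OrderedField.Carrier F)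
                          (M : OrderedField.Carrier F) (m n : Fin k) where
  open OrderedField F hiding (zero) renaming (_≤_ to infix 4 _≤_; _<_ to infix 4 _<_)
  open OrderedFieldProperties F
  open Simplex F
  open Polytope F k w M m n

  wArc-nonneg : (∀ i → 0# ≤ w i) → ∀ a b → 0# ≤ wArc a b
  wArc-nonneg 0≤w a b = Σ-nonneg (λ i → if-nonneg (inArc k a b i) (0≤w i))

  w≤wArc : (∀ i → 0# ≤ w i) → ∀ a b {i} → inArc k a b i ≡ true → w i ≤ wArc a b
  w≤wArc 0≤w a b {i} i∈ab =
    ≡.subst (_≤ wArc a b) (≡.cong (if_then w i else 0#) i∈ab)
      (term≤Σ (λ j → if-nonneg (inArc k a b j) (0≤w j)) i)

  wArc≉0 : (∀ i → 0# < w i) → ∀ a b {i} → inArc k a b i ≡ true → ¬ wArc a b ≈ 0#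
  wArc≉0 0<w a b {i} i∈ab wArc≈0 =
    proj₂ (<-≤-trans (0<w i) (w≤wArc (proj₁ ∘ 0<w) a b i∈ab)) (sym wArc≈0)

  bound-nonneg : (∀ i → 0# ≤ w i) → 0# ≤ M → ∀ {y} → (∀ i → y i ∈[0,1]) →
                 ∀ a b → 0# ≤ wArc a b + slack a b y
  bound-nonneg 0≤w 0≤M y∈[0,1] a b = ≤-respʳ-≈ (Σ-distrib-+ {k} _ _) (Σ-nonneg λ i →
    ≤-respʳ-≈ (if-distrib-+ (inArc k a b i) _ _)
      (if-nonneg (inArc k a b i) (convex-nonneg (0≤w i) 0≤M (y∈[0,1] i))))

  bound-ones : ∀ a b → wArc a b + slack a b (const 1#) ≈ wArc a b
  bound-ones a b = trans (+-congˡ (Σ-zero slack-term≈0)) (+-identityʳ _)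
    where
    slack-term≈0 : ∀ i → (if inArc k a b i then (M - w i) * (1# - 1#) else 0#) ≈ 0#
    slack-term≈0 i with inArc k a b i
    ... | true  = trans (*-congˡ (-‿inverseʳ 1#)) (zeroʳ _)
    ... | false = refl

  vertices : Fin (suc (suc k)) → Fin (suc k) → Carrier
  vertices = simplex (wArc m n) (const 1#)

  0∷y∈Q : (∀ i → 0# ≤ w i) → 0# ≤ M → ∀ {y} → (∀ i → y i ∈[0,1]) → Q (0# ∷ y)
  0∷y∈Q 0≤w 0≤M y∈[0,1] = y∈[0,1]
                        , AbsLe-nonneg ≤-refl (bound-nonneg 0≤w 0≤M y∈[0,1] m n)
                        , AbsLe-nonneg ≤-refl (bound-nonneg 0≤w 0≤M y∈[0,1] n m)
                        , AbsLe-nonneg ≤-refl 0≤M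

  w̲∷1∈Q : (∀ i → 0# ≤ w i) → wArc m n ≤ wArc n m → wArc n m ≤ M → Q (wArc m n ∷ const 1#)
  w̲∷1∈Q 0≤w w̲≤w̄ w̄≤M = (λ _ → 0≤1 , ≤-refl)
                      , AbsLe-nonneg 0≤w̲ (≤-reflexive (sym (bound-ones m n)))
                      , AbsLe-nonneg 0≤w̲ (≤-respʳ-≈ (sym (bound-ones n m)) w̲≤w̄)
                      , AbsLe-nonneg 0≤w̲ (≤-trans w̲≤w̄ w̄≤M)
    where
    0≤w̲ : 0# ≤ wArc m n
    0≤w̲ = wArc-nonneg 0≤w m n

  vertices⊆Q : (∀ i → 0# ≤ w i) → wArc m n ≤ wArc n m → wArc n m ≤ M → ∀ i → Q (vertices i)
  vertices⊆Q 0≤w w̲≤w̄ w̄≤M = λ where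
      zero          → 0∷y∈Q 0≤w 0≤M (λ _ → ≤-refl , 0≤1)
      (suc zero)    → w̲∷1∈Q 0≤w w̲≤w̄ w̄≤M
      (suc (suc t)) → 0∷y∈Q 0≤w 0≤M (δ∈[0,1] t)
    where
    0≤M : 0# ≤ M
    0≤M = ≤-trans (wArc-nonneg 0≤w n m) w̄≤M

-- Opened only now, since Data.Nat's _≤_ and _<_ would clash with the field's order.
open import Data.Nat using (_≤_; NonZero; _<_; _+_; _∸_)
open import Data.Nat.DivMod using (_%_; n%n≡0; [m+n]%n≡m%n; m<n⇒m%n≡m)
open import Data.Nat.Properties
  using (<-cmp; <⇒≤; <⇒<ᵇ; ≤-<-trans; <-≤-trans; m∸n≤m; m≤n+m; m+n∸m≡n; +-∸-comm;
         +-monoˡ-<; m<n⇒0<n∸m; m<n+o⇒m∸n<o)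
open import Relation.Binary.PropositionalEquality using (refl; sym; trans; cong; subst; module ≡-Reasoning)

[b+k∸a]%k>0 : ∀ {k} .{{_ : NonZero k}} {a b} → a < k → b < k → ¬ a ≡ b →
              0 < (b + k ∸ a) % k
[b+k∸a]%k>0 {k} {a} {b} a<k b<k a≢b with <-cmp a b
... | tri< a<b _ _ = subst (0 <_) (sym (begin
  (b + k ∸ a) % k   ≡⟨ cong (_% k) (+-∸-comm k (<⇒≤ a<b)) ⟩
  (b ∸ a + k) % k   ≡⟨ [m+n]%n≡m%n (b ∸ a) k ⟩
  (b ∸ a) % k       ≡⟨ m<n⇒m%n≡m (≤-<-trans (m∸n≤m b a) b<k) ⟩
  b ∸ a             ∎)) (m<n⇒0<n∸m a<b)
  where open ≡-Reasoning
... | tri≈ _ a≡b _ = contradiction a≡b a≢b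
... | tri> _ _ b<a = subst (0 <_) (sym (m<n⇒m%n≡m (m<n+o⇒m∸n<o (b + k) a (+-monoˡ-< k b<a))))
                           (m<n⇒0<n∸m (<-≤-trans a<k (m≤n+m k b)))

[m+n∸m]%n≡0 : ∀ m n → (m + suc n ∸ m) % suc n ≡ 0
[m+n∸m]%n≡0 m n = trans (cong (_% suc n) (m+n∸m≡n m (suc n))) (n%n≡0 (suc n))

inArc-source : ∀ {k} {a b : Fin k} → ¬ a ≡ b → inArc k a b a ≡ true
inArc-source {suc k} {a} {b} a≢b rewrite [m+n∸m]%n≡0 (toℕ a) k =
  Equivalence.to T-≡ (<⇒<ᵇ ([b+k∸a]%k>0 (toℕ<n a) (toℕ<n b) (a≢b ∘ toℕ-injective)))

proposition1 : ∀ {c ℓ} (F : OrderedField c ℓ) (k : ℕ) → 3 ≤ k →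
               (w : Fin k → OrderedField.Carrier F) →
               (∀ i → OrderedField._<_ F (OrderedField.0# F) (w i)) →
               (M : OrderedField.Carrier F) (m n : Fin k) → ¬ (m ≡ n) →
               OrderedField._<_ F (Polytope.wArc F k w M m n m n) (Polytope.wArc F k w M m n n m) →
               OrderedField._<_ F (Polytope.wArc F k w M m n n m) M →
               FullDimensional F (suc k) (Polytope.Q F k w M m n)
proposition1 F k _ w 0<w M m n m≢n w̲<w̄ w̄<M =
  vertices ,
  vertices⊆Q (proj₁ ∘ 0<w) (proj₁ w̲<w̄) (proj₁ w̄<M) ,
  simplex-affinelyIndependent _ (wArc≉0 0<w m n (inArc-source m≢n))
  where
  open Simplex F using (simplex-affinelyIndependent)
  open PolytopeProperties F k w M m n using (vertices; vertices⊆Q; wArc≉0)
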